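{- For every integer $p\geq 3$, the set $\mathrm{Excl}(D_p)\cap\{\overline{C}_i : i\in\mathbb{N},\ i\geq 6\}$ is infinite, i.e. infinitely many antiholes $\overline{C}_i$ ($i\ge 6$) do not contain $D_p$ as a contraction.
   Context: Graphs are finite, simple. Contracting an edge $\{u,v\}$ means adding a new vertex adjacent to all neighbours of $u$ and $v$ and deleting $u,v$; $H$ is a contraction of $G$ if obtained by a sequence of edge contractions. $\mathrm{Excl}(H)$ is the class of connected graphs not having $H$ as a contraction. $\overline{C}_i$ is the complement of the cycle on $i$ vertices. For $r\in\mathbb{N}$, $D_r$ is the graph consisting of an edge $\{a_1,a_2\}$ together with $r$ further pairwise non-adjacent vertices each adjacent to both $a_1$ and $a_2$. -}

module Defs where

open import Data.Nat using (ℕ; zero; suc; _≤_; _≡ᵇ_)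
open import Data.Fin using (Fin; zero; suc; toℕ; punchIn; punchOut)
open import Data.Fin.Permutation using (Permutation′; _⟨$⟩ʳ_)
open import Data.Bool using (Bool; true; false; T; not; _∧_; _∨_; if_then_else_)
open import Data.Product using (Σ; _×_; _,_)
open import Relation.Binary.PropositionalEquality using (_≡_; _≢_)
open import Relation.Nullary using (¬_)

Graph : ℕ → Set
Graph n = Fin n → Fin n → Bool

IsSimple : ∀ {n} → Graph n → Set
IsSimple {n} G = (∀ (x y : Fin n) → G x y ≡ G y x) × (∀ (x : Fin n) → G x x ≡ false)

data Reach {n} (G : Graph n) : Fin n → Fin n → Set where
  here : ∀ {x} → Reach G x x
  step : ∀ {x y z} → T (G x y) → Reach G y z → Reach G x z

Connected : ∀ {n} → Graph n → Set
Connected {n} G = ∀ (x y : Fin n) → Reach G x y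

Iso : ∀ {n} → Graph n → Graph n → Set
Iso {n} G H = Σ (Permutation′ n) λ σ → ∀ (x y : Fin n) → G x y ≡ H (σ ⟨$⟩ʳ x) (σ ⟨$⟩ʳ y)

-- Contraction of the edge {u,v} (u ≢ v): the new vertex is `zero`, the
-- remaining vertices V ∖ {u,v} are `suc k`, embedded back into G via `emb`.
module _ {n : ℕ} (G : Graph (suc (suc n))) (u v : Fin (suc (suc n))) (u≢v : u ≢ v) where
  emb : Fin n → Fin (suc (suc n))
  emb k = punchIn u (punchIn (punchOut u≢v) k)

  contract : Graph (suc n)
  contract zero    zero    = false
  contract zero    (suc k) = G u (emb k) ∨ G v (emb k)
  contract (suc k) zero    = G u (emb k) ∨ G v (emb k)
  contract (suc j) (suc k) = G (emb j) (emb k)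

data ContractsTo : ∀ {m n} → Graph m → Graph n → Set where
  done : ∀ {n} {G H : Graph n} → Iso G H → ContractsTo G H
  edge : ∀ {n m} {G : Graph (suc (suc n))} {H : Graph m}
           (u v : Fin (suc (suc n))) (u≢v : u ≢ v) → T (G u v) →
           ContractsTo (contract G u v u≢v) H → ContractsTo G H

Excl : ∀ {m} → Graph m → ∀ {n} → Graph n → Set
Excl H G = IsSimple G × Connected G × ¬ ContractsTo G H

succMod : (n : ℕ) → Fin n → ℕ
succMod n a = if suc (toℕ a) ≡ᵇ n then 0 else suc (toℕ a)

cycleAdj : (n : ℕ) → Fin n → Fin n → Bool
cycleAdj n a b = (succMod n a ≡ᵇ toℕ b) ∨ (succMod n b ≡ᵇ toℕ a)

antihole : (n : ℕ) → Graph n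
antihole n a b = not (toℕ a ≡ᵇ toℕ b) ∧ not (cycleAdj n a b)

-- D_r: vertex 0 = a₁, vertex 1 = a₂, vertices 2.. are the r further vertices.
D : (r : ℕ) → Graph (suc (suc r))
D r zero          zero          = false
D r zero          (suc zero)    = true
D r (suc zero)    zero          = true
D r (suc zero)    (suc zero)    = false
D r zero          (suc (suc _)) = true
D r (suc (suc _)) zero          = true
D r (suc zero)    (suc (suc _)) = true
D r (suc (suc _)) (suc zero)    = true
D r (suc (suc _)) (suc (suc _)) = false

-- A contraction never creates a larger independent set: an independent set of the
-- contracted graph lifts to one of the original graph, the merged vertex lifting to an
-- endpoint of the contracted edge. The p ≥ 3 leaves of D_p are independent, while an
-- independent triple of the antihole of C_n is a triangle of C_n, which does not exist
-- for n ≥ 4. Hence no antihole of size at least 4 contracts to D_p, and those of size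
-- at least 6 are moreover connected.
module Submission where

open import Defs
open import Data.Nat using (ℕ; zero; suc; _+_; _≤_; _≡ᵇ_; s≤s)
open import Data.Nat.Properties using (≡ᵇ⇒≡; ≡⇒≡ᵇ; suc-injective; m≤m+n; m≤n+m; m≢1+n+m)
open import Data.Fin using (Fin; zero; suc; toℕ)
open import Data.Fin.Properties using (toℕ-injective; punchIn-injective; punchInᵢ≢i)
open import Data.Fin.Permutation using (_⟨$⟩ʳ_; _⟨$⟩ˡ_; inverseʳ)
open import Data.Bool using (true; false; T; not; _∧_; if_then_else_)
open import Data.Bool.Properties using (∨-comm; ∨-conicalˡ; T-≡; T-∨)
open import Data.Unit using (tt)
open import Data.Empty using (⊥; ⊥-elim)
open import Data.Sum as Sum using (_⊎_; inj₁; inj₂)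
open import Data.Product using (Σ; _×_; _,_; proj₁)
open import Function using (_∘_)
open import Function.Bundles using (Equivalence)
open import Relation.Binary.PropositionalEquality
open import Relation.Nullary using (¬_)

private
  variable
    m n : ℕ

NonAdjacent : Graph n → Fin n → Fin n → Set
NonAdjacent G a b = a ≢ b × G a b ≡ false

record IndependentTriple (G : Graph n) : Set where
  constructor triple
  field
    {a b c} : Fin n
    ab : NonAdjacent G a b
    bc : NonAdjacent G b c
    ac : NonAdjacent G a c

independentTriple-pullback : {G : Graph m} {H : Graph n} (f : Fin n → Fin m) →
  (∀ {a b} → NonAdjacent H a b → NonAdjacent G (f a) (f b)) →
  IndependentTriple H → IndependentTriple G
independentTriple-pullback f reflect (triple ab bc ac) =
  triple (reflect ab) (reflect bc) (reflect ac)

iso-nonAdjacent : {G H : Graph n} ((σ , _) : Iso G H) {a b : Fin n} →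
  NonAdjacent H a b → NonAdjacent G (σ ⟨$⟩ˡ a) (σ ⟨$⟩ˡ b)
iso-nonAdjacent {H = H} (σ , G≡Hσ) (a≢b , Hab) =
    (λ eq → a≢b (trans (sym (inverseʳ σ)) (trans (cong (σ ⟨$⟩ʳ_) eq) (inverseʳ σ))))
  , trans (G≡Hσ _ _) (trans (cong₂ H (inverseʳ σ) (inverseʳ σ)) Hab)

IsSymmetric : Graph n → Set
IsSymmetric {n} G = ∀ (x y : Fin n) → G x y ≡ G y x

module _ (G : Graph (suc (suc n))) (u v : Fin (suc (suc n))) (u≢v : u ≢ v) where

  contract-symmetric : IsSymmetric G → IsSymmetric (contract G u v u≢v)
  contract-symmetric _     zero    zero    = refl
  contract-symmetric _     zero    (suc k) = refl
  contract-symmetric _     (suc j) zero    = refl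
  contract-symmetric sym-G (suc j) (suc k) = sym-G _ _

  uncontract : Fin (suc n) → Fin (suc (suc n))
  uncontract zero    = u
  uncontract (suc k) = emb G u v u≢v k

  emb≢u : ∀ k → emb G u v u≢v k ≢ u
  emb≢u k = punchInᵢ≢i u _

  emb-injective : ∀ {j k} → emb G u v u≢v j ≡ emb G u v u≢v k → j ≡ k
  emb-injective = punchIn-injective _ _ _ ∘ punchIn-injective u _ _

  contract-nonAdjacent : IsSymmetric G → ∀ {a b} → NonAdjacent (contract G u v u≢v) a b →
    NonAdjacent G (uncontract a) (uncontract b)
  contract-nonAdjacent _     {zero}  {zero}  (a≢b , _) = ⊥-elim (a≢b refl)
  contract-nonAdjacent _     {zero}  {suc k} (_ , h)   = emb≢u k ∘ sym , ∨-conicalˡ _ _ h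
  contract-nonAdjacent sym-G {suc j} {zero}  (_ , h)   =
    emb≢u j , trans (sym-G _ _) (∨-conicalˡ _ _ h)
  contract-nonAdjacent _     {suc j} {suc k} (a≢b , h) = a≢b ∘ cong suc ∘ emb-injective , h

contractsTo-reflects-independentTriple : {G : Graph m} {H : Graph n} → IsSymmetric G →
  ContractsTo G H → IndependentTriple H → IndependentTriple G
contractsTo-reflects-independentTriple _ (done iso) =
  independentTriple-pullback _ (iso-nonAdjacent iso)
contractsTo-reflects-independentTriple sym-G (edge {G = G} u v u≢v _ G↠H) =
  independentTriple-pullback _ (contract-nonAdjacent G u v u≢v sym-G)
  ∘ contractsTo-reflects-independentTriple (contract-symmetric G u v u≢v sym-G) G↠H

D-independentTriple : ∀ {p} → 3 ≤ p → IndependentTriple (D p)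
D-independentTriple (s≤s (s≤s (s≤s _))) =
  triple {a = suc (suc zero)} {b = suc (suc (suc zero))} {c = suc (suc (suc (suc zero)))}
    ((λ ()) , refl) ((λ ()) , refl) ((λ ()) , refl)

-- succMod n a unfolds to cycleSucc n (toℕ a).
cycleSucc : ℕ → ℕ → ℕ
cycleSucc n k = if suc k ≡ᵇ n then 0 else suc k

CycleEdge : ℕ → ℕ → ℕ → Set
CycleEdge n x y = cycleSucc n x ≡ y ⊎ cycleSucc n y ≡ x

cycleSucc-cases : ∀ n k → (suc k ≡ n × cycleSucc n k ≡ 0) ⊎ cycleSucc n k ≡ suc k
cycleSucc-cases n k with suc k ≡ᵇ n in eq
... | true  = inj₁ (≡ᵇ⇒≡ _ _ (subst T (sym eq) tt) , refl)
... | false = inj₂ refl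

cycleSucc-injective : ∀ n {x y} → cycleSucc n x ≡ cycleSucc n y → x ≡ y
cycleSucc-injective n {x} {y} eq with cycleSucc-cases n x | cycleSucc-cases n y
... | inj₁ (wx , _) | inj₁ (wy , _) = suc-injective (trans wx (sym wy))
... | inj₁ (_ , sx) | inj₂ sy with () ← trans (sym sx) (trans eq sy)
... | inj₂ sx | inj₁ (_ , sy) with () ← trans (sym sy) (trans (sym eq) sx)
... | inj₂ sx | inj₂ sy = suc-injective (trans (sym sx) (trans eq sy))

-- A wrap at x forces y = 0, z = 1 and x = 2, so the cycle has length 3.
3-cycle-cannot-wrap : 4 ≤ n → ∀ {x y z} → suc x ≡ n × cycleSucc n x ≡ 0 →
  cycleSucc n x ≡ y → cycleSucc n y ≡ z → cycleSucc n z ≡ x → ⊥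
3-cycle-cannot-wrap {n} (s≤s (s≤s (s≤s (s≤s _)))) {x} {y} {z} (wrap , x↦0) x→y y→z z→x
  = 3≢n (trans (cong suc (sym x≡2)) wrap)
  where
  3≢n : 3 ≢ n
  3≢n ()
  y≡0 : y ≡ 0
  y≡0 = trans (sym x→y) x↦0
  z≡1 : z ≡ 1
  z≡1 = trans (sym y→z) (cong (cycleSucc n) y≡0)
  x≡2 : x ≡ 2
  x≡2 = trans (sym z→x) (cong (cycleSucc n) z≡1)

cycleSucc-no-3-cycle : 4 ≤ n → ∀ {x y z} →
  cycleSucc n x ≡ y → cycleSucc n y ≡ z → cycleSucc n z ≡ x → ⊥
cycleSucc-no-3-cycle {n} 4≤n {x} {y} {z} x→y y→z z→x
  with cycleSucc-cases n x | cycleSucc-cases n y | cycleSucc-cases n z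
... | inj₁ wx  | _       | _       = 3-cycle-cannot-wrap 4≤n wx x→y y→z z→x
... | inj₂ _  | inj₁ wy | _       = 3-cycle-cannot-wrap 4≤n wy y→z z→x x→y
... | inj₂ _  | inj₂ _  | inj₁ wz = 3-cycle-cannot-wrap 4≤n wz z→x x→y y→z
... | inj₂ sx | inj₂ sy | inj₂ sz = m≢1+n+m x (begin
  x                         ≡⟨ sym z→x ⟩
  cycleSucc n z             ≡⟨ sz ⟩
  suc z                     ≡⟨ cong suc (sym y→z) ⟩
  suc (cycleSucc n y)       ≡⟨ cong suc sy ⟩
  suc (suc y)               ≡⟨ cong (2 +_) (sym x→y) ⟩
  suc (suc (cycleSucc n x)) ≡⟨ cong (2 +_) sx ⟩
  suc (suc (suc x))         ∎)
  where open ≡-Reasoning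

cycle-triangle-free : 4 ≤ n → ∀ {x y z} → x ≢ y → y ≢ z → x ≢ z →
  CycleEdge n x y → CycleEdge n y z → CycleEdge n x z → ⊥
cycle-triangle-free {n} 4≤n x≢y y≢z x≢z xy yz xz with xy | yz | xz
... | inj₁ x→y | _        | inj₁ x→z = y≢z (trans (sym x→y) x→z)
... | inj₁ x→y | inj₁ y→z | inj₂ z→x = cycleSucc-no-3-cycle 4≤n x→y y→z z→x
... | inj₁ x→y | inj₂ z→y | inj₂ z→x = x≢z (cycleSucc-injective n (trans x→y (sym z→y)))
... | inj₂ y→x | inj₁ y→z | _        = x≢z (trans (sym y→x) y→z)
... | inj₂ y→x | inj₂ z→y | inj₁ x→z = cycleSucc-no-3-cycle 4≤n x→z z→y y→x
... | inj₂ _   | inj₂ z→y | inj₂ z→x = x≢y (trans (sym z→x) z→y)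

≡ᵇ-sym : ∀ x y → (x ≡ᵇ y) ≡ (y ≡ᵇ x)
≡ᵇ-sym zero    zero    = refl
≡ᵇ-sym zero    (suc y) = refl
≡ᵇ-sym (suc x) zero    = refl
≡ᵇ-sym (suc x) (suc y) = ≡ᵇ-sym x y

antihole-symmetric : ∀ n → IsSymmetric (antihole n)
antihole-symmetric n x y =
  cong₂ (λ e c → not e ∧ not c) (≡ᵇ-sym (toℕ x) (toℕ y)) (∨-comm (succMod n x ≡ᵇ toℕ y) _)

antihole-simple : ∀ n → IsSimple (antihole n)
antihole-simple n = antihole-symmetric n ,
  λ x → cong (λ e → not e ∧ not (cycleAdj n x x)) (Equivalence.to T-≡ (≡⇒≡ᵇ (toℕ x) (toℕ x) refl))

antihole-nonAdjacent⇒cycleEdge : ∀ {n} {a b : Fin n} →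
  NonAdjacent (antihole n) a b → CycleEdge n (toℕ a) (toℕ b)
antihole-nonAdjacent⇒cycleEdge {n} {a} {b} nonAdj =
  Sum.map (≡ᵇ⇒≡ _ _) (≡ᵇ⇒≡ _ _) (Equivalence.to T-∨ (cycleAdjacent nonAdj))
  where
  cycleAdjacent : NonAdjacent (antihole n) a b → T (cycleAdj n a b)
  cycleAdjacent (a≢b , h) with toℕ a ≡ᵇ toℕ b in eq | cycleAdj n a b
  ... | true  | _    = ⊥-elim (a≢b (toℕ-injective (≡ᵇ⇒≡ _ _ (subst T (sym eq) tt))))
  ... | false | true = tt
  cycleAdjacent (_ , ()) | false | false

antihole-no-independentTriple : 4 ≤ n → ¬ IndependentTriple (antihole n)
antihole-no-independentTriple 4≤n (triple ab bc ac) =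
  cycle-triangle-free 4≤n (proj₁ ab ∘ toℕ-injective) (proj₁ bc ∘ toℕ-injective)
    (proj₁ ac ∘ toℕ-injective) (antihole-nonAdjacent⇒cycleEdge ab)
    (antihole-nonAdjacent⇒cycleEdge bc) (antihole-nonAdjacent⇒cycleEdge ac)

antihole-not-contractsTo-D : ∀ {p} → 3 ≤ p → 4 ≤ n → ¬ ContractsTo (antihole n) (D p)
antihole-not-contractsTo-D 3≤p 4≤n antihole↠D = antihole-no-independentTriple 4≤n
  (contractsTo-reflects-independentTriple (antihole-symmetric _) antihole↠D (D-independentTriple 3≤p))

Reach-trans : {G : Graph n} {x y z : Fin n} → Reach G x y → Reach G y z → Reach G x z
Reach-trans here         y↝z = y↝z
Reach-trans (step e x↝y) y↝z = step e (Reach-trans x↝y y↝z)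

Reach-sym : {G : Graph n} → IsSymmetric G → {x y : Fin n} → Reach G x y → Reach G y x
Reach-sym sym-G here                 = here
Reach-sym sym-G (step {x} {y} e y↝z) =
  Reach-trans (Reach-sym sym-G y↝z) (step (subst T (sym-G x y) e) here)

connected-via-hub : {G : Graph n} → IsSymmetric G → (hub : Fin n) →
  (∀ x → Reach G x hub) → Connected G
connected-via-hub sym-G hub toHub x y = Reach-trans (toHub x) (Reach-sym sym-G (toHub y))

-- Vertex k is joined to 0 for 2 ≤ k ≤ n − 2, vertex 1 to 3, and the vertices k ≥ 5 to 2.
antihole-connected : ∀ N → Connected (antihole (6 + N))
antihole-connected N = connected-via-hub (antihole-symmetric _) zero toZero
  where
  G = antihole (6 + N)

  5~2 : T (G (suc (suc (suc (suc (suc zero))))) (suc (suc zero)))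
  5~2 with 0 ≡ᵇ N
  ... | true  = tt
  ... | false = tt

  [6+x]~2 : ∀ (x : Fin N) → T (G (suc (suc (suc (suc (suc (suc x)))))) (suc (suc zero)))
  [6+x]~2 x with suc (toℕ x) ≡ᵇ N
  ... | true  = tt
  ... | false = tt

  toZero : ∀ x → Reach G x zero
  toZero zero                                   = here
  toZero (suc zero)                             = step {y = suc (suc (suc zero))} tt (step tt here)
  toZero (suc (suc zero))                       = step tt here
  toZero (suc (suc (suc zero)))                 = step tt here
  toZero (suc (suc (suc (suc zero))))           = step tt here
  toZero (suc (suc (suc (suc (suc zero)))))     = step {y = suc (suc zero)} 5~2 (step tt here)
  toZero (suc (suc (suc (suc (suc (suc x)))))) = step {y = suc (suc zero)} ([6+x]~2 x) (step tt here)

lemma4 : ∀ (p : ℕ) → 3 ≤ p → ∀ (N : ℕ) →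
    Σ ℕ (λ i → N ≤ i × 6 ≤ i × Excl (D p) (antihole i))
lemma4 p 3≤p N =
  6 + N , m≤n+m N 6 , m≤m+n 6 N ,
  antihole-simple (6 + N) , antihole-connected N , antihole-not-contractsTo-D 3≤p (m≤m+n 4 (2 + N))
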